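{- Let $m\in\mathbb{N}$ and let $A_1,\dots,A_m\subset\mathbb{N}_0$ be an $m$-part sum system with $|A_j|=n_j$ and $N=n_1n_2\cdots n_m$. For each $j$ let $C_j=A_j-\frac{\max A_j}{2}$ and $B_j=\{a : a\in C_j,\ a>0\}$. Then \[ C_j=B_j\cup(-B_j)\quad\text{if } n_j \text{ is even},\qquad C_j=B_j\cup\{0\}\cup(-B_j)\quad\text{if } n_j\text{ is odd}, \] and \[ \sum_{j=1}^m C_j=\langle N\rangle-\frac{N-1}{2}. \]
   Context: For $a\in\mathbb{N}$, $\langle a\rangle=\{0,1,\dots,a-1\}$. For sets $X,Y$ of numbers and a number $r$, $X+Y=\{x+y: x\in X, y\in Y\}$ (Minkowski sum), $X-r=\{x-r:x\in X\}$, and $-X=\{ -x:x\in X\}$. An $m$-part sum system is a collection of finite sets $A_1,\dots,A_m\subset\mathbb{N}_0$ with $|A_j|=n_j$ such that $\sum_{j=1}^m A_j=\langle N\rangle$ where $N=n_1\cdots n_m$ (equivalently, every integer $0,\dots,N-1$ is represented exactly once as $a_1+\dots+a_m$ with $a_j\in A_j$). -}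

module Defs where

open import Level using (0ℓ)
open import Data.Nat as ℕ using (ℕ; zero; suc; _⊔_)
open import Data.Fin using (Fin; zero; suc)
open import Data.List using (List; length; foldr)
open import Data.List.Membership.Propositional using (_∈_)
open import Data.List.Relation.Unary.Unique.Propositional using (Unique)
open import Data.List.Relation.Unary.Any using (Any)
open import Data.Integer using (+_)
open import Data.Rational using (ℚ; _/_; _+_; _-_; _*_; -_; 0ℚ; 1ℚ; ½; _<_)
open import Data.Product using (Σ; _×_; ∃)
open import Relation.Binary.PropositionalEquality using (_≡_)
open import Relation.Unary using (Pred)

sumℕ : (m : ℕ) → (Fin m → ℕ) → ℕ
sumℕ zero f = 0
sumℕ (suc m) f = f zero ℕ.+ sumℕ m (λ i → f (suc i))

prodℕ : (m : ℕ) → (Fin m → ℕ) → ℕ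
prodℕ zero f = 1
prodℕ (suc m) f = f zero ℕ.* prodℕ m (λ i → f (suc i))

sumℚ : (m : ℕ) → (Fin m → ℚ) → ℚ
sumℚ zero f = 0ℚ
sumℚ (suc m) f = f zero + sumℚ m (λ i → f (suc i))

-- a finite subset of ℕ₀ is a duplicate-free list; its cardinality is the length
FinSet : Set
FinSet = List ℕ

⟨_⟩ : ℕ → Pred ℕ 0ℓ
⟨ a ⟩ x = x ℕ.< a

MinkSumℕ : (m : ℕ) → (Fin m → FinSet) → Pred ℕ 0ℓ
MinkSumℕ m A x = Σ (Fin m → ℕ) λ a → (∀ j → a j ∈ A j) × sumℕ m a ≡ x

MinkSumℚ : (m : ℕ) → (Fin m → Pred ℚ 0ℓ) → Pred ℚ 0ℓ
MinkSumℚ m C q = Σ (Fin m → ℚ) λ c → (∀ j → C j (c j)) × sumℚ m c ≡ q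

sizes : (m : ℕ) → (Fin m → FinSet) → Fin m → ℕ
sizes m A j = length (A j)

IsSumSystem : (m : ℕ) → (Fin m → FinSet) → Set
IsSumSystem m A =
  (∀ j → Unique (A j)) ×
  (∀ x → (MinkSumℕ m A x → ⟨ prodℕ m (sizes m A) ⟩ x) × (⟨ prodℕ m (sizes m A) ⟩ x → MinkSumℕ m A x))

toℚ : ℕ → ℚ
toℚ n = + n / 1

maxSet : FinSet → ℕ
maxSet = foldr _⊔_ 0

shift : Pred ℚ 0ℓ → ℚ → Pred ℚ 0ℓ
shift X r q = ∃ λ x → X x × q ≡ x - r

neg : Pred ℚ 0ℓ → Pred ℚ 0ℓ
neg X q = ∃ λ x → X x × q ≡ - x

img : Pred ℕ 0ℓ → Pred ℚ 0ℓ
img P q = ∃ λ a → P a × q ≡ toℚ a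

asℚ : FinSet → Pred ℚ 0ℓ
asℚ A = img (_∈ A)

Cset : FinSet → Pred ℚ 0ℓ
Cset A = shift (asℚ A) (toℚ (maxSet A) * ½)

Bset : FinSet → Pred ℚ 0ℓ
Bset A q = Cset A q × 0ℚ < q

module Submission where

-- Fix one of the sets, A with maximum M, and let R be the list of all sums from the other sets.
-- Then A ⊕ R lists N numbers covering ⟨N⟩, so it has no repetitions and the sum is direct. The
-- reflection M − A also gives a direct sum with R, of N elements, all in ⟨N⟩, hence again equal
-- to ⟨N⟩. Since 0 ∈ R, two sets each contained in the other's sum with R coincide (an element of
-- one not in the other would be a + r with a smaller, r > 0, contradicting directness), so A is
-- symmetric: A = M − A and C = A − M/2 = −C. Pairing a with M − a matches the elements below M/2
-- with those above it, so |A| is odd exactly when M/2 ∈ A, i.e. when 0 ∈ C. Finally the maxima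
-- sum to the largest element N − 1 of ⟨N⟩, so the C_j add up to ⟨N⟩ − (N − 1)/2.

module DistinctLists where

  open import Data.Nat using (suc; _≤_; _<_; s≤s; z≤n)
  open import Data.Nat.Properties using (≤-trans; <-≤-trans; <-irrefl; ≤-pred)
  open import Data.List using (List; []; _∷_; _++_; length; map)
  open import Data.List.Relation.Binary.Disjoint.Propositional using (Disjoint)
  open import Data.Product using (_×_; _,_)
  open import Data.List.Properties using (length-removeAt′)
  open import Data.List.Membership.Propositional using (_∈_; _∉_)
  open import Data.List.Relation.Unary.Any using (here; there; index; _─_)
  open import Data.List.Relation.Unary.All using ([]; _∷_; tabulate) renaming (lookup to All-lookup)
  import Data.List.Relation.Unary.All.Properties as All
  open import Data.List.Relation.Unary.AllPairs using ([]; _∷_)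
  open import Data.List.Relation.Unary.Unique.Propositional using (Unique)
  open import Data.List.Relation.Binary.Subset.Propositional using (_⊆_)
  open import Relation.Binary.Definitions using (DecidableEquality)
  open import Relation.Binary.PropositionalEquality using (_≡_; _≢_; refl; sym; subst)
  open import Relation.Nullary using (yes; no; contradiction)
  open import Data.Empty using (⊥; ⊥-elim)

  module _ {a} {A : Set a} where

    ∈-─⁺ : ∀ {v w} {ys : List A} (w∈ys : w ∈ ys) → v ∈ ys → v ≢ w → v ∈ (ys ─ w∈ys)
    ∈-─⁺ (here refl) (here refl) v≢w = contradiction refl v≢w
    ∈-─⁺ (here refl) (there v∈ys) _ = v∈ys
    ∈-─⁺ (there w∈ys) (here refl) _ = here refl
    ∈-─⁺ (there w∈ys) (there v∈ys) v≢w = there (∈-─⁺ w∈ys v∈ys v≢w)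

    ∈-─⁻ : ∀ {v w} {ys : List A} (w∈ys : w ∈ ys) → v ∈ (ys ─ w∈ys) → v ∈ ys
    ∈-─⁻ (here refl) v∈ = there v∈
    ∈-─⁻ (there w∈ys) (here refl) = here refl
    ∈-─⁻ (there w∈ys) (there v∈) = there (∈-─⁻ w∈ys v∈)

    ∉-─ : ∀ {w} {ys : List A} → Unique ys → (w∈ys : w ∈ ys) → w ∉ (ys ─ w∈ys)
    ∉-─ (w∉ys ∷ _) (here refl) w∈ = All-lookup w∉ys w∈ refl
    ∉-─ (y∉ys ∷ _) (there w∈ys) (here refl) = All-lookup y∉ys w∈ys refl
    ∉-─ (_ ∷ ys!) (there w∈ys) (there w∈) = ∉-─ ys! w∈ys w∈

    Unique-─ : ∀ {w} {ys : List A} → Unique ys → (w∈ys : w ∈ ys) → Unique (ys ─ w∈ys)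
    Unique-─ (_ ∷ ys!) (here refl) = ys!
    Unique-─ (y∉ys ∷ ys!) (there w∈ys) = All.─⁺ w∈ys y∉ys ∷ Unique-─ ys! w∈ys

    length-─ : ∀ {w} (ys : List A) (w∈ys : w ∈ ys) → length ys ≡ suc (length (ys ─ w∈ys))
    length-─ ys w∈ys = length-removeAt′ ys (index w∈ys)

    Unique-++⁻ : ∀ (xs : List A) {ys} → Unique (xs ++ ys) → Unique xs × Unique ys × Disjoint xs ys
    Unique-++⁻ [] ys! = [] , ys! , λ ()
    Unique-++⁻ (x ∷ xs) {ys} (x∉ ∷ xs++ys!) with Unique-++⁻ xs xs++ys!
    ... | xs! , ys! , xs#ys = All.++⁻ˡ xs x∉ ∷ xs! , ys! , disjoint
      where
      disjoint : Disjoint (x ∷ xs) ys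
      disjoint (here refl , v∈ys) = All-lookup (All.++⁻ʳ xs x∉) v∈ys refl
      disjoint (there v∈xs , v∈ys) = xs#ys (v∈xs , v∈ys)

    Unique-allEqual⇒length≤1 : ∀ {xs : List A} → Unique xs → (∀ {x y} → x ∈ xs → y ∈ xs → x ≡ y) → length xs ≤ 1
    Unique-allEqual⇒length≤1 {[]} _ _ = z≤n
    Unique-allEqual⇒length≤1 {_ ∷ []} _ _ = s≤s z≤n
    Unique-allEqual⇒length≤1 {_ ∷ _ ∷ _} ((x≢y ∷ _) ∷ _) allEqual = contradiction (allEqual (here refl) (there (here refl))) x≢y

  module _ {a b} {A : Set a} {B : Set b} where

    injective⇒length≤ : ∀ (f : A → B) {xs : List A} {ys : List B} → Unique xs →
                        (∀ {x y} → x ∈ xs → y ∈ xs → f x ≡ f y → x ≡ y) →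
                        (∀ {x} → x ∈ xs → f x ∈ ys) → length xs ≤ length ys
    injective⇒length≤ f {[]} _ _ _ = z≤n
    injective⇒length≤ f {x ∷ xs} {ys} (x∉xs ∷ xs!) inj maps =
      subst (suc (length xs) ≤_) (sym (length-─ ys fx∈ys))
        (s≤s (injective⇒length≤ f xs! (λ p q → inj (there p) (there q)) maps-─))
      where
      fx∈ys : f x ∈ ys
      fx∈ys = maps (here refl)
      maps-─ : ∀ {y} → y ∈ xs → f y ∈ (ys ─ fx∈ys)
      maps-─ y∈xs = ∈-─⁺ fx∈ys (maps (there y∈xs))
        λ fy≡fx → All-lookup x∉xs y∈xs (sym (inj (there y∈xs) (here refl) fy≡fx))

    Unique-map⁺ : ∀ (f : A → B) {xs : List A} → (∀ {x y} → x ∈ xs → y ∈ xs → f x ≡ f y → x ≡ y) →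
                  Unique xs → Unique (map f xs)
    Unique-map⁺ f {[]} _ [] = []
    Unique-map⁺ f {x ∷ xs} inj (x∉xs ∷ xs!) =
      All.map⁺ (tabulate λ y∈xs fx≡fy → All-lookup x∉xs y∈xs (inj (here refl) (there y∈xs) fx≡fy))
      ∷ Unique-map⁺ f (λ p q → inj (there p) (there q)) xs!

  module _ {a} {A : Set a} where

    Unique-⊆⇒length≤ : ∀ {xs ys : List A} → Unique xs → xs ⊆ ys → length xs ≤ length ys
    Unique-⊆⇒length≤ xs! xs⊆ys = injective⇒length≤ (λ x → x) xs! (λ _ _ eq → eq) xs⊆ys

    Unique-⊂⇒length< : ∀ {w} {xs ys : List A} → Unique xs → xs ⊆ ys → w ∈ ys → w ∉ xs → length xs < length ys
    Unique-⊂⇒length< {xs = xs} {ys} xs! xs⊆ys w∈ys w∉xs =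
      subst (length xs <_) (sym (length-─ ys w∈ys)) (s≤s (Unique-⊆⇒length≤ xs! xs⊆ys─w))
      where
      xs⊆ys─w : xs ⊆ (ys ─ w∈ys)
      xs⊆ys─w x∈xs = ∈-─⁺ w∈ys (xs⊆ys x∈xs) λ { refl → w∉xs x∈xs }

    module _ (_≟_ : DecidableEquality A) where
      open import Data.List.Membership.DecPropositional _≟_ using (_∈?_)

      Unique-⊆-length≥⇒⊇ : ∀ {xs ys : List A} → Unique xs → xs ⊆ ys → length ys ≤ length xs → ys ⊆ xs
      Unique-⊆-length≥⇒⊇ {xs} xs! xs⊆ys ys≤xs {y} y∈ys with y ∈? xs
      ... | yes y∈xs = y∈xs
      ... | no y∉xs = contradiction (<-≤-trans (Unique-⊂⇒length< xs! xs⊆ys y∈ys y∉xs) ys≤xs) (<-irrefl refl)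

      ⊇-length≤⇒Unique : ∀ {xs ys : List A} → Unique ys → ys ⊆ xs → length xs ≤ length ys → Unique xs
      ⊇-length≤⇒Unique {[]} _ _ _ = []
      ⊇-length≤⇒Unique {x ∷ xs} {ys} ys! ys⊆x∷xs x∷xs≤ys = All.¬Any⇒All¬ xs x∉xs ∷ xs!
        where
        too-long : ys ⊆ xs → ⊥
        too-long ys⊆xs = <-irrefl refl (≤-trans x∷xs≤ys (Unique-⊆⇒length≤ ys! ys⊆xs))
        x∉xs : x ∉ xs
        x∉xs x∈xs = too-long λ y∈ys → x∷xs⊆xs (ys⊆x∷xs y∈ys)
          where
          x∷xs⊆xs : x ∷ xs ⊆ xs
          x∷xs⊆xs (here refl) = x∈xs
          x∷xs⊆xs (there y∈xs) = y∈xs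
        xs! : Unique xs
        xs! with x ∈? ys
        ... | no x∉ys = ⊥-elim (too-long λ y∈ys → drop-x y∈ys (ys⊆x∷xs y∈ys))
          where
          drop-x : ∀ {y} → y ∈ ys → y ∈ x ∷ xs → y ∈ xs
          drop-x y∈ys (here refl) = contradiction y∈ys x∉ys
          drop-x _ (there y∈xs) = y∈xs
        ... | yes x∈ys = ⊇-length≤⇒Unique (Unique-─ ys! x∈ys) ys─x⊆xs
                           (≤-pred (subst (length (x ∷ xs) ≤_) (length-─ ys x∈ys) x∷xs≤ys))
          where
          ys─x⊆xs : (ys ─ x∈ys) ⊆ xs
          ys─x⊆xs y∈ with ys⊆x∷xs (∈-─⁻ x∈ys y∈)
          ... | here refl = contradiction y∈ (∉-─ ys! x∈ys)
          ... | there y∈xs = y∈xs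

module Sumsets where

  open DistinctLists
  open import Data.Nat using (ℕ; zero; suc; _+_; _*_; _∸_; _≤_; _<_; _≟_; z≤n; s≤s)
  open import Data.Nat.Properties
  open import Data.Nat.Induction using (<-rec)
  open import Data.Nat.Solver using (module +-*-Solver)
  open import Data.List using (List; []; _∷_; _++_; length; map; upTo; cartesianProductWith)
  open import Data.List.Properties using (length-++; length-map; length-upTo)
  open import Data.List.Membership.Propositional using (_∈_)
  open import Data.List.Membership.Propositional.Properties
    using (∈-map⁺; ∈-map⁻; ∈-upTo⁺; ∈-upTo⁻; ∈-cartesianProductWith⁺; ∈-cartesianProductWith⁻)
  open import Data.List.Relation.Unary.Any using (here; there)
  open import Data.List.Relation.Unary.All using () renaming (lookup to All-lookup)
  open import Data.List.Relation.Unary.AllPairs using ([]; _∷_)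
  open import Data.List.Relation.Unary.Unique.Propositional using (Unique)
  import Data.List.Relation.Unary.Unique.Propositional.Properties as Unique
  open import Data.List.Relation.Binary.Subset.Propositional using (_⊆_)
  open import Data.Product using (_×_; _,_; ∃₂; proj₁; proj₂)
  open import Data.Empty using (⊥-elim)
  open import Data.List.Relation.Binary.Disjoint.Propositional using (Disjoint)
  open import Data.Sum using (inj₁; inj₂)
  open import Relation.Binary.PropositionalEquality
  open import Relation.Nullary using (contradiction)
  open import Defs using (maxSet)
  open import Function using (_∘_)

  infixl 6 _⊕_

  _⊕_ : List ℕ → List ℕ → List ℕ
  _⊕_ = cartesianProductWith _+_

  ∈-⊕⁺ : ∀ {A R a r} → a ∈ A → r ∈ R → a + r ∈ A ⊕ R
  ∈-⊕⁺ = ∈-cartesianProductWith⁺ _+_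

  ∈-⊕⁻ : ∀ A R {x} → x ∈ A ⊕ R → ∃₂ λ a r → a ∈ A × r ∈ R × x ≡ a + r
  ∈-⊕⁻ = ∈-cartesianProductWith⁻ _+_

  length-⊕ : ∀ A R → length (A ⊕ R) ≡ length A * length R
  length-⊕ [] R = refl
  length-⊕ (a ∷ A) R = begin
    length (map (a +_) R ++ A ⊕ R)        ≡⟨ length-++ (map (a +_) R) ⟩
    length (map (a +_) R) + length (A ⊕ R) ≡⟨ cong₂ _+_ (length-map (a +_) R) (length-⊕ A R) ⟩
    length R + length A * length R          ∎
    where open ≡-Reasoning

  ⊆-⊕ : ∀ {A R} → 0 ∈ R → A ⊆ A ⊕ R
  ⊆-⊕ {A} {R} 0∈R {a} a∈A = subst (_∈ A ⊕ R) (+-identityʳ a) (∈-⊕⁺ a∈A 0∈R)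

  Direct : List ℕ → List ℕ → Set
  Direct A R = ∀ {a a′ r r′} → a ∈ A → a′ ∈ A → r ∈ R → r′ ∈ R → a + r ≡ a′ + r′ → a ≡ a′

  Unique⇒Direct : ∀ A {R} → Unique (A ⊕ R) → Direct A R
  Unique⇒Direct (a ∷ A) {R} A⊕R! with Unique-++⁻ (map (a +_) R) A⊕R!
  ... | _ , A⊕R! , a+R#A⊕R = λ where
    (here refl) (here refl) _ _ _ → refl
    (here refl) (there a′∈A) r∈R r′∈R e →
      ⊥-elim (a+R#A⊕R (∈-map⁺ (a +_) r∈R , subst (_∈ A ⊕ R) (sym e) (∈-⊕⁺ a′∈A r′∈R)))
    (there a∈A) (here refl) r∈R r′∈R e →
      ⊥-elim (a+R#A⊕R (∈-map⁺ (a +_) r′∈R , subst (_∈ A ⊕ R) e (∈-⊕⁺ a∈A r∈R)))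
    (there a∈A) (there a′∈A) → Unique⇒Direct A A⊕R! a∈A a′∈A

  Unique-⊕⁺ : ∀ {A R} → Unique A → Unique R → Direct A R → Unique (A ⊕ R)
  Unique-⊕⁺ {[]} _ _ _ = []
  Unique-⊕⁺ {a ∷ A} {R} (a∉A ∷ A!) R! direct =
    Unique.++⁺ (Unique.map⁺ (+-cancelˡ-≡ a _ _) R!) (Unique-⊕⁺ A! R! (λ p q → direct (there p) (there q))) a+R#A⊕R
    where
    a+R#A⊕R : Disjoint (map (a +_) R) (A ⊕ R)
    a+R#A⊕R (x∈a+R , x∈A⊕R) with ∈-map⁻ (a +_) x∈a+R | ∈-⊕⁻ A R x∈A⊕R
    ... | r , r∈R , refl | a′ , r′ , a′∈A , r′∈R , e =
      All-lookup a∉A a′∈A (direct (here refl) (there a′∈A) r∈R r′∈R e)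

  Unique-⊕⁻ʳ : ∀ {A R a} → a ∈ A → Unique (A ⊕ R) → Unique R
  Unique-⊕⁻ʳ {a ∷ A} {R} (here refl) A⊕R! = Unique.map⁻ (proj₁ (Unique-++⁻ (map (a +_) R) A⊕R!))
  Unique-⊕⁻ʳ {a ∷ A} {R} (there a′∈A) A⊕R! = Unique-⊕⁻ʳ a′∈A (proj₁ (proj₂ (Unique-++⁻ (map (a +_) R) A⊕R!)))

  module _ {R : List ℕ} (0∈R : 0 ∈ R) where

    direct-⊕-cancelʳ-step : ∀ {A A′} → Direct A R → A ⊆ A′ ⊕ R → ∀ x → (∀ {y} → y < x → y ∈ A′ → y ∈ A) → x ∈ A → x ∈ A′
    direct-⊕-cancelʳ-step {A} {A′} direct A⊆A′⊕R x below x∈A with ∈-⊕⁻ A′ R (A⊆A′⊕R x∈A)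
    ... | a , zero , a∈A′ , _ , x≡a+0 = subst (_∈ A′) (sym (trans x≡a+0 (+-identityʳ a))) a∈A′
    ... | a , suc r , a∈A′ , r∈R , x≡a+r = contradiction a≡x (<⇒≢ a<x)
      where
      a<x : a < x
      a<x = subst (a <_) (sym x≡a+r) (m<m+n a (s≤s z≤n))
      a≡x : a ≡ x
      a≡x = direct (below a<x a∈A′) x∈A r∈R 0∈R (trans (sym x≡a+r) (sym (+-identityʳ x)))

    direct-⊕-cancelʳ : ∀ {A A′} → Direct A R → Direct A′ R → A ⊆ A′ ⊕ R → A′ ⊆ A ⊕ R → A′ ⊆ A
    direct-⊕-cancelʳ {A} {A′} direct direct′ A⊆A′⊕R A′⊆A⊕R {x} = proj₂ (<-rec P step x)
      where
      P : ℕ → Set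
      P x = (x ∈ A → x ∈ A′) × (x ∈ A′ → x ∈ A)
      step : ∀ x → (∀ {y} → y < x → P y) → P x
      step x ih = direct-⊕-cancelʳ-step direct A⊆A′⊕R x (λ y<x → proj₂ (ih y<x))
                , direct-⊕-cancelʳ-step direct′ A′⊆A⊕R x (λ y<x → proj₁ (ih y<x))

  ≤-maxSet : ∀ {A a} → a ∈ A → a ≤ maxSet A
  ≤-maxSet {x ∷ A} (here refl) = m≤m⊔n x (maxSet A)
  ≤-maxSet {x ∷ A} (there a∈A) = ≤-trans (≤-maxSet a∈A) (m≤n⊔m x (maxSet A))

  maxSet-∈ : ∀ {A a} → a ∈ A → maxSet A ∈ A
  maxSet-∈ {x ∷ A} _ = maxSet-∷-∈ x A
    where
    maxSet-∷-∈ : ∀ x A → maxSet (x ∷ A) ∈ x ∷ A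
    maxSet-∷-∈ x [] = here (⊔-identityʳ x)
    maxSet-∷-∈ x (y ∷ A) with ⊔-sel x (maxSet (y ∷ A))
    ... | inj₁ x⊔m≡x = here x⊔m≡x
    ... | inj₂ x⊔m≡m = there (subst (_∈ y ∷ A) (sym x⊔m≡m) (maxSet-∷-∈ y A))

  reflect : ℕ → List ℕ → List ℕ
  reflect M = map (M ∸_)

  module _ {M : ℕ} {A : List ℕ} (≤M : ∀ {a} → a ∈ A → a ≤ M) where

    Unique-reflect : Unique A → Unique (reflect M A)
    Unique-reflect = Unique-map⁺ (M ∸_) λ a∈A b∈A → ∸-cancelˡ-≡ (≤M a∈A) (≤M b∈A)

    Direct-reflect : ∀ {R} → Direct A R → Direct (reflect M A) R
    Direct-reflect {R} direct {x} {x′} {r} {r′} x∈ x′∈ r∈R r′∈R e with ∈-map⁻ (M ∸_) x∈ | ∈-map⁻ (M ∸_) x′∈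
    ... | b , b∈A , refl | b′ , b′∈A , refl =
      cong (M ∸_) (sym (direct b′∈A b∈A r∈R r′∈R (swap-reflected (≤M b∈A) (≤M b′∈A) e)))
      where
      swap-reflected : ∀ {b b′ r r′} → b ≤ M → b′ ≤ M → (M ∸ b) + r ≡ (M ∸ b′) + r′ → b′ + r ≡ b + r′
      swap-reflected {b} {b′} {r} {r′} b≤M b′≤M e = +-cancelˡ-≡ M _ _ (begin
        M + (b′ + r)               ≡⟨ cong (_+ (b′ + r)) (sym (m∸n+n≡m b≤M)) ⟩
        (M ∸ b) + b + (b′ + r)     ≡⟨ solve 4 (λ c b b′ r → c :+ b :+ (b′ :+ r) := (c :+ r) :+ (b :+ b′)) refl (M ∸ b) b b′ r ⟩
        (M ∸ b) + r + (b + b′)     ≡⟨ cong (_+ (b + b′)) e ⟩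
        (M ∸ b′) + r′ + (b + b′)   ≡⟨ solve 4 (λ c b b′ r′ → (c :+ r′) :+ (b :+ b′) := c :+ b′ :+ (b :+ r′)) refl (M ∸ b′) b b′ r′ ⟩
        (M ∸ b′) + b′ + (b + r′)   ≡⟨ cong (_+ (b + r′)) (m∸n+n≡m b′≤M) ⟩
        M + (b + r′)               ∎)
        where
        open ≡-Reasoning
        open +-*-Solver

  module _ {A R : List ℕ} {N : ℕ} (N>0 : 0 < N) (A! : Unique A)
           (sound : A ⊕ R ⊆ upTo N) (complete : upTo N ⊆ A ⊕ R) (size : length A * length R ≡ N) where

    tiling-symmetric : ∀ {a} → a ∈ A → maxSet A ∸ a ∈ A
    tiling-symmetric a∈A = direct-⊕-cancelʳ 0∈R direct direct* A⊆A*⊕R A*⊆A⊕R (∈-map⁺ (M ∸_) a∈A)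
      where
      M : ℕ
      M = maxSet A
      A* : List ℕ
      A* = reflect M A
      length-⊕R : ∀ X → length X ≡ length A → length (X ⊕ R) ≡ length (upTo N)
      length-⊕R X |X|≡|A| = trans (length-⊕ X R) (trans (cong (_* length R) |X|≡|A|) (trans size (sym (length-upTo N))))
      A⊕R! : Unique (A ⊕ R)
      A⊕R! = ⊇-length≤⇒Unique _≟_ (Unique.upTo⁺ N) complete (≤-reflexive (length-⊕R A refl))
      direct : Direct A R
      direct = Unique⇒Direct A A⊕R!
      direct* : Direct A* R
      direct* = Direct-reflect ≤-maxSet direct
      0∈R : 0 ∈ R
      0∈R with ∈-⊕⁻ A R (complete (∈-upTo⁺ N>0))
      ... | a , r , _ , r∈R , 0≡a+r = subst (_∈ R) (m+n≡0⇒n≡0 a (sym 0≡a+r)) r∈R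
      sound* : A* ⊕ R ⊆ upTo N
      sound* x∈ with ∈-⊕⁻ A* R x∈
      ... | _ , r , b*∈A* , r∈R , refl with ∈-map⁻ (M ∸_) b*∈A*
      ... | b , _ , refl =
        ∈-upTo⁺ (≤-<-trans (+-monoˡ-≤ r (m∸n≤m M b)) (∈-upTo⁻ (sound (∈-⊕⁺ (maxSet-∈ a∈A) r∈R))))
      complete* : upTo N ⊆ A* ⊕ R
      complete* = Unique-⊆-length≥⇒⊇ _≟_ (Unique-⊕⁺ (Unique-reflect ≤-maxSet A!) (Unique-⊕⁻ʳ a∈A A⊕R!) direct*)
        sound* (≤-reflexive (sym (length-⊕R A* (length-map (M ∸_) A))))
      A⊆A*⊕R : A ⊆ A* ⊕ R
      A⊆A*⊕R = complete* ∘ sound ∘ ⊆-⊕ 0∈R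
      A*⊆A⊕R : A* ⊆ A ⊕ R
      A*⊆A⊕R = complete ∘ sound* ∘ ⊆-⊕ 0∈R

module Midpoints where

  open DistinctLists
  open import Data.Nat using (ℕ; suc; _+_; _*_; _∸_; _≤_; _<_; _≟_; _<?_; _%_; s≤s)
  open import Data.Nat.Properties
  open import Data.Nat.DivMod using ([m+kn]%n≡m%n; m<n⇒m%n≡m)
  open import Data.Nat.Solver using (module +-*-Solver)
  open import Data.List using (List; []; _∷_; length; filter)
  open import Data.List.Properties using (filter-accept; filter-reject; filter-some; filter-none)
  open import Data.List.Membership.Propositional using (_∈_; find; lose)
  open import Data.List.Membership.Propositional.Properties using (∈-filter⁺; ∈-filter⁻)
  open import Data.List.Relation.Unary.Any using (any?)
  open import Data.List.Relation.Unary.All.Properties using (¬Any⇒All¬)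
  open import Data.List.Relation.Unary.Unique.Propositional using (Unique)
  import Data.List.Relation.Unary.Unique.Propositional.Properties as Unique
  open import Data.Product using (_×_; _,_; ∃; proj₁; proj₂)
  open import Relation.Binary.Definitions using (tri<; tri≈; tri>)
  open import Relation.Binary.PropositionalEquality
  import Relation.Unary as U
  open import Relation.Nullary using (Dec; yes; no; contradiction)

  +-double-injective : ∀ {x y} → x + x ≡ y + y → x ≡ y
  +-double-injective {x} {y} e = trans (n≡⌊n+n/2⌋ x) (trans (cong ⌊_/2⌋ e) (sym (n≡⌊n+n/2⌋ y)))
    where open import Data.Nat using (⌊_/2⌋)

  module _ (M : ℕ) where

    below? : ∀ y → Dec (y + y < M)
    below? y = y + y <? M

    mid? : ∀ y → Dec (y + y ≡ M)
    mid? y = y + y ≟ M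

    above? : ∀ y → Dec (M < y + y)
    above? y = M <? y + y

    length-trichotomy : ∀ A → length A ≡ length (filter below? A) + length (filter mid? A) + length (filter above? A)
    length-trichotomy [] = refl
    length-trichotomy (y ∷ A) with <-cmp (y + y) M
    ... | tri< lt ¬eq ¬gt
      rewrite filter-accept below? {y} {A} lt | filter-reject mid? {y} {A} ¬eq | filter-reject above? {y} {A} ¬gt
      = cong suc (length-trichotomy A)
    ... | tri≈ ¬lt eq ¬gt
      rewrite filter-reject below? {y} {A} ¬lt | filter-accept mid? {y} {A} eq | filter-reject above? {y} {A} ¬gt
      = trans (cong suc (length-trichotomy A)) (cong (_+ length (filter above? A)) (sym (+-suc _ _)))
    ... | tri> ¬lt ¬eq gt
      rewrite filter-reject below? {y} {A} ¬lt | filter-reject mid? {y} {A} ¬eq | filter-accept above? {y} {A} gt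
      = trans (cong suc (length-trichotomy A)) (sym (+-suc _ _))

    module _ {A : List ℕ} (A! : Unique A) (≤M : ∀ {a} → a ∈ A → a ≤ M) (closed : ∀ {a} → a ∈ A → M ∸ a ∈ A) where

      private
        reflect-injective : ∀ {P : ℕ → Set} (P? : U.Decidable P) {x y} →
                            x ∈ filter P? A → y ∈ filter P? A → M ∸ x ≡ M ∸ y → x ≡ y
        reflect-injective P? x∈ y∈ = ∸-cancelˡ-≡ (≤M (proj₁ (∈-filter⁻ P? x∈))) (≤M (proj₁ (∈-filter⁻ P? y∈)))

        below⇒above : ∀ x y → x + y ≡ M → x + x < M → M < y + y
        below⇒above x y x+y≡M x+x<M =
          subst (_< y + y) x+y≡M (+-monoˡ-< y (+-cancelˡ-< x x y (subst (x + x <_) (sym x+y≡M) x+x<M)))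

        above⇒below : ∀ x y → x + y ≡ M → M < x + x → y + y < M
        above⇒below x y x+y≡M M<x+x =
          subst (y + y <_) x+y≡M (+-monoˡ-< y (+-cancelˡ-< x y x (subst (_< x + x) (sym x+y≡M) M<x+x)))

        reflect-maps : ∀ {P Q : ℕ → Set} (P? : U.Decidable P) (Q? : U.Decidable Q) →
                       (∀ x y → x + y ≡ M → P x → Q y) → ∀ {x} → x ∈ filter P? A → M ∸ x ∈ filter Q? A
        reflect-maps P? Q? P⇒Q x∈ with ∈-filter⁻ P? x∈
        ... | x∈A , Px = ∈-filter⁺ Q? (closed x∈A) (P⇒Q _ _ (m+[n∸m]≡n (≤M x∈A)) Px)

      length-below≡above : length (filter below? A) ≡ length (filter above? A)
      length-below≡above = ≤-antisym
        (injective⇒length≤ (M ∸_) (Unique.filter⁺ below? A!) (reflect-injective below?) (reflect-maps below? above? below⇒above))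
        (injective⇒length≤ (M ∸_) (Unique.filter⁺ above? A!) (reflect-injective above?) (reflect-maps above? below? above⇒below))

      length-mid≤1 : length (filter mid? A) ≤ 1
      length-mid≤1 = Unique-allEqual⇒length≤1 (Unique.filter⁺ mid? A!) λ x∈ y∈ →
        +-double-injective (trans (proj₂ (∈-filter⁻ mid? {xs = A} x∈)) (sym (proj₂ (∈-filter⁻ mid? {xs = A} y∈))))

      length%2≡length-mid : length A % 2 ≡ length (filter mid? A)
      length%2≡length-mid = begin
        length A % 2                          ≡⟨ cong (_% 2) (length-trichotomy A) ⟩
        (below + mid + above) % 2             ≡⟨ cong (λ n → (below + mid + n) % 2) (sym length-below≡above) ⟩
        (below + mid + below) % 2             ≡⟨ cong (_% 2) (solve 2 (λ b m → b :+ m :+ b := m :+ b :* con 2) refl below mid) ⟩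
        (mid + below * 2) % 2                 ≡⟨ [m+kn]%n≡m%n mid below 2 ⟩
        mid % 2                               ≡⟨ m<n⇒m%n≡m (s≤s length-mid≤1) ⟩
        mid                                   ∎
        where
        open ≡-Reasoning
        open +-*-Solver
        below mid above : ℕ
        below = length (filter below? A)
        mid = length (filter mid? A)
        above = length (filter above? A)

      odd⇒midpoint : length A % 2 ≡ 1 → ∃ λ a → a ∈ A × a + a ≡ M
      odd⇒midpoint odd with any? mid? A
      ... | yes some = find some
      ... | no none = contradiction (trans (sym odd) (trans length%2≡length-mid
                        (cong length (filter-none mid? (¬Any⇒All¬ A none))))) λ ()

      even⇒no-midpoint : length A % 2 ≡ 0 → ∀ {a} → a ∈ A → a + a ≢ M
      even⇒no-midpoint even a∈A a+a≡M =
        <-irrefl (trans (sym even) length%2≡length-mid) (filter-some mid? (lose a∈A a+a≡M))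

module SumSystems where

  open DistinctLists
  open Sumsets
  open import Defs
  open import Data.Nat using (ℕ; zero; suc; _+_; _*_; _∸_; _≤_; _<_; z≤n; s≤s)
  open import Data.Nat.Properties
  open import Data.Fin using (Fin; zero; suc; punchIn)
  open import Data.Vec.Functional using (removeAt; insertAt)
  open import Data.List using (List; []; _∷_; [_]; length; upTo)
  open import Data.List.Membership.Propositional using (_∈_)
  open import Data.List.Membership.Propositional.Properties using (∈-upTo⁺; ∈-upTo⁻; ∈-length)
  open import Data.List.Relation.Binary.Subset.Propositional using (_⊆_)
  open import Relation.Nullary using (contradiction)
  open import Data.List.Relation.Unary.Any using (here)
  open import Data.Product using (_,_; ∃; proj₁; proj₂)
  open import Function using (_∘_)
  open import Relation.Binary.PropositionalEquality hiding ([_])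
  import Algebra.Properties.CommutativeSemigroup as CommSemigroup

  private
    module + = CommSemigroup +-commutativeSemigroup
    module * = CommSemigroup *-commutativeSemigroup

  sumℕ-removeAt : ∀ m (f : Fin (suc m) → ℕ) j → sumℕ (suc m) f ≡ f j + sumℕ m (removeAt f j)
  sumℕ-removeAt m f zero = refl
  sumℕ-removeAt (suc m) f (suc j) =
    trans (cong (f zero +_) (sumℕ-removeAt m (f ∘ suc) j)) (+.x∙yz≈y∙xz (f zero) (f (suc j)) _)

  prodℕ-removeAt : ∀ m (f : Fin (suc m) → ℕ) j → prodℕ (suc m) f ≡ f j * prodℕ m (removeAt f j)
  prodℕ-removeAt m f zero = refl
  prodℕ-removeAt (suc m) f (suc j) =
    trans (cong (f zero *_) (prodℕ-removeAt m (f ∘ suc) j)) (*.x∙yz≈y∙xz (f zero) (f (suc j)) _)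

  sumℕ-insertAt : ∀ m (t : Fin m → ℕ) j b → sumℕ (suc m) (insertAt t j b) ≡ b + sumℕ m t
  sumℕ-insertAt m t zero b = refl
  sumℕ-insertAt (suc m) t (suc j) b =
    trans (cong (t zero +_) (sumℕ-insertAt m (t ∘ suc) j b)) (+.x∙yz≈y∙xz (t zero) b _)

  insertAt-∈ : ∀ m (A : Fin (suc m) → List ℕ) (t : Fin m → ℕ) j {b} →
               b ∈ A j → (∀ k → t k ∈ A (punchIn j k)) → ∀ i → insertAt t j b i ∈ A i
  insertAt-∈ m A t zero b∈ t∈ zero = b∈
  insertAt-∈ m A t zero b∈ t∈ (suc i) = t∈ i
  insertAt-∈ (suc m) A t (suc j) b∈ t∈ zero = t∈ zero
  insertAt-∈ (suc m) A t (suc j) b∈ t∈ (suc i) = insertAt-∈ m (A ∘ suc) (t ∘ suc) j b∈ (t∈ ∘ suc) i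

  prodℕ-pos : ∀ m (f : Fin m → ℕ) → (∀ j → 0 < f j) → 0 < prodℕ m f
  prodℕ-pos zero f _ = s≤s z≤n
  prodℕ-pos (suc m) f pos = *-mono-< (pos zero) (prodℕ-pos m (f ∘ suc) (pos ∘ suc))

  sumℕ-mono-≤ : ∀ m {f g : Fin m → ℕ} → (∀ j → f j ≤ g j) → sumℕ m f ≤ sumℕ m g
  sumℕ-mono-≤ zero _ = z≤n
  sumℕ-mono-≤ (suc m) f≤g = +-mono-≤ (f≤g zero) (sumℕ-mono-≤ m (f≤g ∘ suc))

  sums : (m : ℕ) → (Fin m → List ℕ) → List ℕ
  sums zero A = [ 0 ]
  sums (suc m) A = A zero ⊕ sums m (A ∘ suc)

  ∈-sums⁺ : ∀ m A {x} → MinkSumℕ m A x → x ∈ sums m A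
  ∈-sums⁺ zero A (a , _ , refl) = here refl
  ∈-sums⁺ (suc m) A (a , a∈A , refl) = ∈-⊕⁺ (a∈A zero) (∈-sums⁺ m (A ∘ suc) (a ∘ suc , a∈A ∘ suc , refl))

  ∈-sums⁻ : ∀ m A {x} → x ∈ sums m A → MinkSumℕ m A x
  ∈-sums⁻ zero A (here refl) = (λ ()) , (λ ()) , refl
  ∈-sums⁻ (suc m) A x∈ with ∈-⊕⁻ (A zero) (sums m (A ∘ suc)) x∈
  ... | b , r , b∈A₀ , r∈ , refl with ∈-sums⁻ m (A ∘ suc) r∈
  ... | t , t∈ , refl = insertAt t zero b , insertAt-∈ m A t zero b∈A₀ t∈ , refl

  length-sums : ∀ m A → length (sums m A) ≡ prodℕ m (sizes m A)
  length-sums zero A = refl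
  length-sums (suc m) A = trans (length-⊕ (A zero) _) (cong (length (A zero) *_) (length-sums m (A ∘ suc)))

  module _ {m} (A : Fin (suc m) → List ℕ) (j : Fin (suc m)) where

    MinkSumℕ⇒∈-⊕-removeAt : ∀ {x} → MinkSumℕ (suc m) A x → x ∈ A j ⊕ sums m (removeAt A j)
    MinkSumℕ⇒∈-⊕-removeAt (a , a∈A , refl) =
      subst (_∈ A j ⊕ sums m (removeAt A j)) (sym (sumℕ-removeAt m a j))
        (∈-⊕⁺ (a∈A j) (∈-sums⁺ m (removeAt A j) (removeAt a j , a∈A ∘ punchIn j , refl)))

    ∈-⊕-removeAt⇒MinkSumℕ : ∀ {x} → x ∈ A j ⊕ sums m (removeAt A j) → MinkSumℕ (suc m) A x
    ∈-⊕-removeAt⇒MinkSumℕ x∈ with ∈-⊕⁻ (A j) (sums m (removeAt A j)) x∈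
    ... | b , r , b∈Aj , r∈ , refl with ∈-sums⁻ m (removeAt A j) r∈
    ... | t , t∈ , refl = insertAt t j b , insertAt-∈ m A t j b∈Aj t∈ , sumℕ-insertAt m t j b

  nonempty⇒∈ : ∀ {A : List ℕ} → A ≢ [] → ∃ (_∈ A)
  nonempty⇒∈ {[]} A≢[] = contradiction refl A≢[]
  nonempty⇒∈ {a ∷ A} _ = a , here refl

  prodℕ-sizes-pos : ∀ m (A : Fin m → List ℕ) → (∀ j → A j ≢ []) → 0 < prodℕ m (sizes m A)
  prodℕ-sizes-pos m A nonempty = prodℕ-pos m (sizes m A) (λ j → ∈-length (proj₂ (nonempty⇒∈ (nonempty j))))

  IsSumSystem-symmetric : ∀ {m} {A : Fin m → FinSet} → IsSumSystem m A → (∀ j → A j ≢ []) →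
                        ∀ j {a} → a ∈ A j → maxSet (A j) ∸ a ∈ A j
  IsSumSystem-symmetric {suc m} {A} (A! , sumset) nonempty j =
    tiling-symmetric (prodℕ-sizes-pos (suc m) A nonempty) (A! j) sound complete size
    where
    N : ℕ
    N = prodℕ (suc m) (sizes (suc m) A)
    R : List ℕ
    R = sums m (removeAt A j)
    sound : A j ⊕ R ⊆ upTo N
    sound x∈ = ∈-upTo⁺ (proj₁ (sumset _) (∈-⊕-removeAt⇒MinkSumℕ A j x∈))
    complete : upTo N ⊆ A j ⊕ R
    complete x∈ = MinkSumℕ⇒∈-⊕-removeAt A j (proj₂ (sumset _) (∈-upTo⁻ x∈))
    size : length (A j) * length R ≡ N
    size = trans (cong (length (A j) *_) (length-sums m (removeAt A j))) (sym (prodℕ-removeAt m (sizes (suc m) A) j))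

  suc-sumℕ-maxSet : ∀ {m} {A : Fin m → FinSet} → IsSumSystem m A → (∀ j → A j ≢ []) →
                    suc (sumℕ m (maxSet ∘ A)) ≡ prodℕ m (sizes m A)
  suc-sumℕ-maxSet {m} {A} (_ , sumset) nonempty = ≤-antisym S<N (subst (_≤ suc S) (m+[n∸m]≡n N>0) (s≤s N∸1≤S))
    where
    N S : ℕ
    N = prodℕ m (sizes m A)
    S = sumℕ m (maxSet ∘ A)
    N>0 : 0 < N
    N>0 = prodℕ-sizes-pos m A nonempty
    S<N : S < N
    S<N = proj₁ (sumset S) (maxSet ∘ A , (λ j → maxSet-∈ (proj₂ (nonempty⇒∈ (nonempty j)))) , refl)
    N∸1≤S : N ∸ 1 ≤ S
    N∸1≤S with proj₂ (sumset (N ∸ 1)) (subst (N ∸ 1 <_) (m+[n∸m]≡n N>0) ≤-refl)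
    ... | a , a∈A , Σa≡N∸1 = subst (_≤ S) Σa≡N∸1 (sumℕ-mono-≤ m (λ j → ≤-maxSet (a∈A j)))

open Sumsets using (≤-maxSet)
open Midpoints using (odd⇒midpoint; even⇒no-midpoint)
open SumSystems using (IsSumSystem-symmetric; suc-sumℕ-maxSet)

open import Defs
open import Data.Nat using (ℕ; _%_)
open import Data.Fin using (Fin; zero; suc)
open import Data.List using ([])
open import Data.Rational using (_-_; _*_; 1ℚ; ½; 0ℚ)
open import Data.Product using (_×_)
open import Relation.Binary.PropositionalEquality using (_≡_; _≢_)
open import Relation.Unary using (_≐_; _∪_; ｛_｝)

import Data.Nat as ℕ
import Data.Nat.Properties as ℕ
import Data.Nat.Coprimality as Coprime
import Data.Integer as ℤ
import Data.Integer.Properties as ℤ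
open import Data.Rational using (ℚ; mkℚ; _+_; -_; _<_)
open import Data.Rational.Properties using (normalize-coprime; /-cong; <-cmp; neg-antimono-<; +-0-group)
open import Data.Rational.Solver using (module +-*-Solver)
open import Algebra.Properties.Group +-0-group using (⁻¹-involutive)
open import Data.List using (List; length)
open import Data.List.Membership.Propositional using (_∈_)
open import Data.List.Relation.Unary.Unique.Propositional using (Unique)
open import Data.Product using (∃; _,_; proj₁; proj₂)
open import Data.Sum using (inj₁; inj₂)
open import Level using (0ℓ)
open import Function using (_∘_)
open import Relation.Unary using (Pred)
open import Relation.Binary.Definitions using (tri<; tri≈; tri>)
open import Relation.Binary.PropositionalEquality using (refl; sym; trans; cong; cong₂; subst; module ≡-Reasoning)
open import Relation.Nullary using (¬_; contradiction)
open +-*-Solver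

toℚ≡mkℚ : ∀ a → toℚ a ≡ mkℚ (ℤ.+ a) 0 (Coprime.sym (Coprime.1-coprimeTo a))
toℚ≡mkℚ a = normalize-coprime (Coprime.sym (Coprime.1-coprimeTo a))

toℚ-+ : ∀ a b → toℚ (a ℕ.+ b) ≡ toℚ a + toℚ b
toℚ-+ a b rewrite toℚ≡mkℚ a | toℚ≡mkℚ b =
  /-cong (cong₂ ℤ._+_ (sym (ℤ.*-identityʳ (ℤ.+ a))) (sym (ℤ.*-identityʳ (ℤ.+ b)))) refl

toℚ-injective : ∀ {a b} → toℚ a ≡ toℚ b → a ≡ b
toℚ-injective {a} {b} e with trans (sym (toℚ≡mkℚ a)) (trans e (toℚ≡mkℚ b))
... | refl = refl

centred : ℕ → ℕ → ℚ
centred M a = toℚ a - toℚ M * ½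

Cset-intro : ∀ {A a} → a ∈ A → Cset A (centred (maxSet A) a)
Cset-intro {a = a} a∈A = toℚ a , (a , a∈A , refl) , refl

Cset-elim : ∀ {A q} → Cset A q → ∃ λ a → a ∈ A × q ≡ centred (maxSet A) a
Cset-elim {A} (_ , (a , a∈A , refl) , refl) = a , a∈A , refl

neg-centred : ∀ {M a} → a ℕ.≤ M → - centred M a ≡ centred M (M ℕ.∸ a)
neg-centred {M} {a} a≤M = begin
  - (toℚ a - toℚ M * ½)                          ≡⟨ cong (λ x → - (toℚ a - x * ½)) toℚM ⟩
  - (toℚ a - (toℚ (M ℕ.∸ a) + toℚ a) * ½)        ≡⟨ solve 2 (λ x y → :- (y :- (x :+ y) :* con ½) := x :- (x :+ y) :* con ½) refl (toℚ (M ℕ.∸ a)) (toℚ a) ⟩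
  toℚ (M ℕ.∸ a) - (toℚ (M ℕ.∸ a) + toℚ a) * ½    ≡⟨ cong (λ x → toℚ (M ℕ.∸ a) - x * ½) (sym toℚM) ⟩
  toℚ (M ℕ.∸ a) - toℚ M * ½                      ∎
  where
  open ≡-Reasoning
  toℚM : toℚ M ≡ toℚ (M ℕ.∸ a) + toℚ a
  toℚM = trans (cong toℚ (sym (ℕ.m∸n+n≡m a≤M))) (toℚ-+ (M ℕ.∸ a) a)

centred≡0⇒midpoint : ∀ M a → centred M a ≡ 0ℚ → a ℕ.+ a ≡ M
centred≡0⇒midpoint M a e = toℚ-injective (begin
  toℚ (a ℕ.+ a)                          ≡⟨ toℚ-+ a a ⟩
  toℚ a + toℚ a                          ≡⟨ solve 2 (λ x m → x :+ x := (x :- m :* con ½) :* con (toℚ 2) :+ m) refl (toℚ a) (toℚ M) ⟩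
  centred M a * toℚ 2 + toℚ M            ≡⟨ cong (λ c → c * toℚ 2 + toℚ M) e ⟩
  0ℚ * toℚ 2 + toℚ M                     ≡⟨ solve 1 (λ m → con 0ℚ :* con (toℚ 2) :+ m := m) refl (toℚ M) ⟩
  toℚ M                                  ∎)
  where open ≡-Reasoning

midpoint⇒centred≡0 : ∀ M a → a ℕ.+ a ≡ M → centred M a ≡ 0ℚ
midpoint⇒centred≡0 _ a refl = begin
  toℚ a - toℚ (a ℕ.+ a) * ½    ≡⟨ cong (λ x → toℚ a - x * ½) (toℚ-+ a a) ⟩
  toℚ a - (toℚ a + toℚ a) * ½  ≡⟨ solve 1 (λ x → x :- (x :+ x) :* con ½ := con 0ℚ) refl (toℚ a) ⟩
  0ℚ                           ∎
  where open ≡-Reasoning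

sumℚ-centred : ∀ m (M a : Fin m → ℕ) → sumℚ m (λ j → centred (M j) (a j)) ≡ centred (sumℕ m M) (sumℕ m a)
sumℚ-centred ℕ.zero M a = solve 0 (con 0ℚ := con (toℚ 0) :- con (toℚ 0) :* con ½) refl
sumℚ-centred (ℕ.suc m) M a = begin
  centred (M zero) (a zero) + sumℚ m (λ j → centred (M (suc j)) (a (suc j)))
    ≡⟨ cong (centred (M zero) (a zero) +_) (sumℚ-centred m (M ∘ suc) (a ∘ suc)) ⟩
  (toℚ (a zero) - toℚ (M zero) * ½) + (toℚ Σa - toℚ ΣM * ½)
    ≡⟨ solve 4 (λ x X y Y → (x :- y :* con ½) :+ (X :- Y :* con ½) := (x :+ X) :- (y :+ Y) :* con ½) refl
         (toℚ (a zero)) (toℚ Σa) (toℚ (M zero)) (toℚ ΣM) ⟩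
  (toℚ (a zero) + toℚ Σa) - (toℚ (M zero) + toℚ ΣM) * ½
    ≡⟨ sym (cong₂ (λ x y → x - y * ½) (toℚ-+ (a zero) Σa) (toℚ-+ (M zero) ΣM)) ⟩
  centred (M zero ℕ.+ ΣM) (a zero ℕ.+ Σa) ∎
  where
  open ≡-Reasoning
  Σa ΣM : ℕ
  Σa = sumℕ m (a ∘ suc)
  ΣM = sumℕ m (M ∘ suc)

module _ (C : Pred ℚ 0ℓ) (neg-closed : ∀ {q} → C q → C (- q)) where

  private
    B : Pred ℚ 0ℓ
    B q = C q × 0ℚ < q

    negative⇒neg-B : ∀ {q} → C q → q < 0ℚ → neg B q
    negative⇒neg-B {q} Cq q<0 = - q , (neg-closed Cq , neg-antimono-< q<0) , sym (⁻¹-involutive q)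

    neg-B⊆C : ∀ {q} → neg B q → C q
    neg-B⊆C (_ , (Cq , _) , refl) = neg-closed Cq

  neg-closed-split : ¬ C 0ℚ → C ≐ (B ∪ neg B)
  neg-closed-split ¬C0 = split , λ { (inj₁ (Cq , _)) → Cq ; (inj₂ negB) → neg-B⊆C negB }
    where
    split : ∀ {q} → C q → (B ∪ neg B) q
    split {q} Cq with <-cmp q 0ℚ
    ... | tri< q<0 _ _ = inj₂ (negative⇒neg-B Cq q<0)
    ... | tri≈ _ refl _ = contradiction Cq ¬C0
    ... | tri> _ _ q>0 = inj₁ (Cq , q>0)

  neg-closed-split-0 : C 0ℚ → C ≐ (B ∪ (｛ 0ℚ ｝ ∪ neg B))
  neg-closed-split-0 C0 = split , unsplit
    where
    unsplit : ∀ {q} → (B ∪ (｛ 0ℚ ｝ ∪ neg B)) q → C q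
    unsplit (inj₁ (Cq , _)) = Cq
    unsplit (inj₂ (inj₁ refl)) = C0
    unsplit (inj₂ (inj₂ negB)) = neg-B⊆C negB
    split : ∀ {q} → C q → (B ∪ (｛ 0ℚ ｝ ∪ neg B)) q
    split {q} Cq with <-cmp q 0ℚ
    ... | tri< q<0 _ _ = inj₂ (inj₂ (negative⇒neg-B Cq q<0))
    ... | tri≈ _ q≡0 _ = inj₂ (inj₁ (sym q≡0))
    ... | tri> _ _ q>0 = inj₁ (Cq , q>0)

module _ {A : List ℕ} (A! : Unique A) (reflect-closed : ∀ {a} → a ∈ A → maxSet A ℕ.∸ a ∈ A) where

  private
    M : ℕ
    M = maxSet A

    Cset-neg-closed : ∀ {q} → Cset A q → Cset A (- q)
    Cset-neg-closed Cq with Cset-elim Cq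
    ... | a , a∈A , refl = subst (Cset A) (sym (neg-centred (≤-maxSet a∈A))) (Cset-intro (reflect-closed a∈A))

  Cset-even-split : length A % 2 ≡ 0 → Cset A ≐ (Bset A ∪ neg (Bset A))
  Cset-even-split even = neg-closed-split (Cset A) Cset-neg-closed ¬C0
    where
    ¬C0 : ¬ Cset A 0ℚ
    ¬C0 C0 with Cset-elim C0
    ... | a , a∈A , 0≡c = even⇒no-midpoint M A! ≤-maxSet reflect-closed even a∈A (centred≡0⇒midpoint M a (sym 0≡c))

  Cset-odd-split : length A % 2 ≡ 1 → Cset A ≐ (Bset A ∪ (｛ 0ℚ ｝ ∪ neg (Bset A)))
  Cset-odd-split odd with odd⇒midpoint M A! ≤-maxSet reflect-closed odd
  ... | a , a∈A , a+a≡M = neg-closed-split-0 (Cset A) Cset-neg-closed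
                            (subst (Cset A) (midpoint⇒centred≡0 M a a+a≡M) (Cset-intro a∈A))

sumℚ-cong : ∀ m {f g : Fin m → ℚ} → (∀ j → f j ≡ g j) → sumℚ m f ≡ sumℚ m g
sumℚ-cong ℕ.zero _ = refl
sumℚ-cong (ℕ.suc m) f≡g = cong₂ _+_ (f≡g zero) (sumℚ-cong m (f≡g ∘ suc))

module _ {m} {A : Fin m → FinSet} (system : IsSumSystem m A) (nonempty : ∀ j → A j ≢ []) where

  private
    M : Fin m → ℕ
    M = maxSet ∘ A

    N S : ℕ
    N = prodℕ m (sizes m A)
    S = sumℕ m M

    offset : (toℚ N - 1ℚ) * ½ ≡ toℚ S * ½
    offset = begin
      (toℚ N - 1ℚ) * ½              ≡⟨ cong (λ n → (toℚ n - 1ℚ) * ½) (sym (suc-sumℕ-maxSet system nonempty)) ⟩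
      (toℚ (1 ℕ.+ S) - 1ℚ) * ½      ≡⟨ cong (λ x → (x - 1ℚ) * ½) (toℚ-+ 1 S) ⟩
      (1ℚ + toℚ S - 1ℚ) * ½         ≡⟨ solve 1 (λ x → (con 1ℚ :+ x :- con 1ℚ) :* con ½ := x :* con ½) refl (toℚ S) ⟩
      toℚ S * ½                     ∎
      where open ≡-Reasoning

    sum-centred : ∀ (a : Fin m → ℕ) → sumℚ m (λ j → centred (M j) (a j)) ≡ toℚ (sumℕ m a) - (toℚ N - 1ℚ) * ½
    sum-centred a = trans (sumℚ-centred m M a) (cong (λ r → toℚ (sumℕ m a) - r) (sym offset))

  MinkSumℚ-Cset : MinkSumℚ m (λ j → Cset (A j)) ≐ shift (img ⟨ N ⟩) ((toℚ N - 1ℚ) * ½)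
  MinkSumℚ-Cset = sound , complete
    where
    sound : ∀ {q} → MinkSumℚ m (λ j → Cset (A j)) q → shift (img ⟨ N ⟩) ((toℚ N - 1ℚ) * ½) q
    sound (c , c∈C , refl) = toℚ (sumℕ m a) , (sumℕ m a , Σa<N , refl) , trans (sumℚ-cong m c≡) (sum-centred a)
      where
      a : Fin m → ℕ
      a j = proj₁ (Cset-elim (c∈C j))
      a∈A : ∀ j → a j ∈ A j
      a∈A j = proj₁ (proj₂ (Cset-elim (c∈C j)))
      c≡ : ∀ j → c j ≡ centred (M j) (a j)
      c≡ j = proj₂ (proj₂ (Cset-elim (c∈C j)))
      Σa<N : sumℕ m a ℕ.< N
      Σa<N = proj₁ (proj₂ system _) (a , a∈A , refl)
    complete : ∀ {q} → shift (img ⟨ N ⟩) ((toℚ N - 1ℚ) * ½) q → MinkSumℚ m (λ j → Cset (A j)) q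
    complete (_ , (x , x<N , refl) , refl) with proj₂ (proj₂ system x) x<N
    ... | a , a∈A , refl = (λ j → centred (M j) (a j)) , (λ j → Cset-intro (a∈A j)) , sum-centred a

lemma1p2 : (m : ℕ) (A : Fin m → FinSet) →
    IsSumSystem m A →
    (∀ j → A j ≢ []) →
    (∀ j → (sizes m A j % 2 ≡ 0 → Cset (A j) ≐ (Bset (A j) ∪ neg (Bset (A j))))
         × (sizes m A j % 2 ≡ 1 → Cset (A j) ≐ (Bset (A j) ∪ (｛ 0ℚ ｝ ∪ neg (Bset (A j))))))
    × (MinkSumℚ m (λ j → Cset (A j))
        ≐ shift (img ⟨ prodℕ m (sizes m A) ⟩) ((toℚ (prodℕ m (sizes m A)) - 1ℚ) * ½))
lemma1p2 m A system nonempty =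
    (λ j → Cset-even-split (proj₁ system j) (IsSumSystem-symmetric system nonempty j)
         , Cset-odd-split (proj₁ system j) (IsSumSystem-symmetric system nonempty j))
  , MinkSumℚ-Cset system nonempty
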